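{- For every integer $k\ge 3$, $\mathcal M_{2,k}^{k}\not\to\mathcal M_{2,k}^{k+1}$.
   Context: $\mathbf{LO}_k^r$ is the $r$-ary structure with domain $[k]=\{1,\dots,k\}$ and relation consisting of all tuples in $[k]^r$ with a unique maximum. For $r$-ary structures $\mathbf{A},\mathbf{B}$, a $p$-ary polymorphism is a function $f: A^p\to B$ such that whenever an $r\times p$ matrix has every column in the relation of $\mathbf A$, applying $f$ to each row yields a tuple in the relation of $\mathbf B$. $\mathrm{Pol}(\mathbf A,\mathbf B)$ is the minion of all polymorphisms with minors $f_\pi(x_1,\dots,x_q)=f(x_{\pi(1)},\dots,x_{\pi(p)})$ for $\pi:[p]\to[q]$. $\mathcal{M}_{2,k}^r = \mathrm{Pol}(\mathbf{LO}_2^r,\mathbf{LO}_k^r)$. A minion homomorphism $\xi:\mathcal M\to\mathcal N$ maps $p$-ary elements to $p$-ary elements with $\xi(f)_\pi=\xi(f_\pi)$ for all $\pi,f$; $\mathcal M\not\to\mathcal N$ means no such homomorphism exists. -}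

module Defs where

open import Data.Nat using (ℕ; suc)
open import Data.Fin using (Fin; _<_)
open import Data.Product using (Σ; ∃; _,_; proj₁; proj₂)
open import Relation.Binary.PropositionalEquality using (_≡_; _≢_)
open import Relation.Nullary using (¬_)

LO : (k r : ℕ) → (Fin r → Fin k) → Set
LO k r t = ∃ λ i → ∀ j → j ≢ i → t j < t i

IsPol : (r k p : ℕ) → ((Fin p → Fin 2) → Fin k) → Set
IsPol r k p f =
  (M : Fin r → Fin p → Fin 2) →
  (∀ c → LO 2 r (λ i → M i c)) →
  LO k r (λ i → f (M i))

-- The minion M_{2,k}^r = Pol(LO_2^r, LO_k^r): p-ary elements.
Pol : (r k p : ℕ) → Set
Pol r k p = Σ ((Fin p → Fin 2) → Fin k) (IsPol r k p)

fun : ∀ {r k p} → Pol r k p → (Fin p → Fin 2) → Fin k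
fun = proj₁

minorFun : ∀ {k p q} → (Fin p → Fin q) → ((Fin p → Fin 2) → Fin k) → (Fin q → Fin 2) → Fin k
minorFun π f x = f (λ c → x (π c))

minor : ∀ {r k p q} → (Fin p → Fin q) → Pol r k p → Pol r k q
minor π (f , pf) = minorFun π f , λ M cols → pf (λ i c → M i (π c)) (λ c → cols (π c))

-- Minion homomorphism M_{2,k}^r → M_{2,k'}^{r'}: arity-preserving map on
-- polymorphisms (as functions, i.e. respecting extensional equality)
-- commuting with minors (pointwise equality of functions).
record MinionHom (r k r' k' : ℕ) : Set where
  field
    ξ : ∀ {p} → Pol r k p → Pol r' k' p
    ξ-ext : ∀ {p} (f g : Pol r k p) → (∀ x → fun f x ≡ fun g x) → ∀ x → fun (ξ f) x ≡ fun (ξ g) x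
    ξ-minor : ∀ {p q} (π : Fin p → Fin q) (f : Pol r k p) →
              ∀ x → fun (ξ (minor π f)) x ≡ minorFun π (fun (ξ f)) x

NoHom : (r k r' k' : ℕ) → Set
NoHom r k r' k' = ¬ MinionHom r k r' k'

-- Write spike i : [p] → [2] for the map sending i to 0 and everything else
-- to 1.  With n = k − 1 columns and k rows, every 0/1 matrix whose columns
-- each contain exactly one 1 has a row that stands out: the only empty row if
-- no two columns share a row, and otherwise the row of the first column c
-- sharing its row, since every other row has at most one 1 or has its first
-- 1 after c.  Scoring rows accordingly yields an n-ary polymorphism
-- LO₂ᵏ → LOₖᵏ all of whose minors along the spikes coincide.  Minion
-- homomorphisms preserve identities between minors, so its image would be an
-- n-ary polymorphism LO₂ᵏ⁺¹ → LOₖᵏ⁺¹ with coinciding spike minors.  That is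
-- impossible: on the matrix with two zero rows above the n indicator rows,
-- the zero rows get equal values, and so do the indicator rows, which are the
-- images of one binary tuple under the spike minors.
module Submission where

open import Defs
open import Data.Nat using (ℕ; _≤_; suc; zero; _+_; _∸_)
import Data.Nat as ℕ
import Data.Nat.Properties as ℕₚ
open import Data.Fin using (Fin; zero; suc; toℕ; fromℕ<; inject; opposite; _<_; _≟_)
import Data.Fin.Properties as Finₚ
open import Data.Empty using (⊥; ⊥-elim)
open import Data.Maybe using (Maybe; nothing; just)
import Data.Maybe as Maybe
open import Data.Product using (∃; _,_; proj₁; proj₂; _×_)
open import Function using (_∘_)
open import Function.Definitions using (Injective)
open import Relation.Nullary using (¬_; Dec; yes; no; contradiction)
open import Relation.Nullary.Decidable using (¬?; _×-dec_; decidable-stable)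
open import Relation.Binary.PropositionalEquality
  using (_≡_; _≢_; _≗_; refl; sym; trans; cong; cong₂; subst; subst₂; module ≡-Reasoning)

<-Fin2 : {a b : Fin 2} → a < b → a ≡ zero × b ≡ suc zero
<-Fin2 {zero}     {suc zero} _           = refl , refl
<-Fin2 {suc zero} {suc zero} (ℕ.s≤s ())

≢0⇒≡1 : {a : Fin 2} → a ≢ zero → a ≡ suc zero
≢0⇒≡1 {zero}     a≢0 = contradiction refl a≢0
≢0⇒≡1 {suc zero} _   = refl

≢1⇒≡0 : {a : Fin 2} → a ≢ suc zero → a ≡ zero
≢1⇒≡0 {zero}     _   = refl
≢1⇒≡0 {suc zero} a≢1 = contradiction refl a≢1

LO₂-top : ∀ {r} {t : Fin (2 + r) → Fin 2} (lo : LO 2 (2 + r) t) → t (proj₁ lo) ≡ suc zero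
LO₂-top (zero  , max) = proj₂ (<-Fin2 (max (suc zero) λ ()))
LO₂-top (suc _ , max) = proj₂ (<-Fin2 (max zero λ ()))

LO₂-rest : ∀ {r} {t : Fin r → Fin 2} (lo : LO 2 r t) → ∀ j → j ≢ proj₁ lo → t j ≡ zero
LO₂-rest (_ , max) j j≢i = proj₁ (<-Fin2 (max j j≢i))

StrictMax : ∀ {r} → (Fin r → ℕ) → Set
StrictMax t = ∃ λ w → ∀ r → r ≢ w → t r ℕ.< t w

constant-except : ∀ {n} {A : Set} {f : Fin n → A} {i a} →
                  f i ≡ a → (∀ c → c ≢ i → f c ≡ a) → ∀ c → f c ≡ a
constant-except {i = i} fi others c with c ≟ i
... | yes refl = fi
... | no c≢i   = others c c≢i

¬∀⟶∃¬-least : ∀ {n} {P : Fin n → Set} → (∀ i → Dec (P i)) → ¬ (∀ i → P i) →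
                ∃ λ i → ¬ P i × (∀ j → j < i → P j)
¬∀⟶∃¬-least {n} {P} P? ¬∀P with i , ¬Pi , below ← Finₚ.¬∀⟶∃¬-smallest n P P? ¬∀P =
  i , ¬Pi , λ j j<i → subst P (inject-fromℕ< j<i) (below (fromℕ< j<i))
  where
  inject-fromℕ< : ∀ {j} (j<i : j < i) → inject {i = i} (fromℕ< j<i) ≡ j
  inject-fromℕ< j<i = Finₚ.toℕ-injective (trans (Finₚ.toℕ-inject _) (Finₚ.toℕ-fromℕ< j<i))

some-value-missed : ∀ {n} (f : Fin n → Fin (suc n)) → ∃ λ e → ∀ c → f c ≢ e
some-value-missed f with Finₚ.any? (λ e → Finₚ.all? (λ c → ¬? (f c ≟ e)))
... | yes missed = missed
... | no ¬missed = ⊥-elim (Finₚ.<⇒notInjective (ℕₚ.n<1+n _) section-injective)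
  where
  preimage : ∀ e → ∃ λ c → f c ≡ e
  preimage e with c , ¬fc≢e ← Finₚ.¬∀⟶∃¬ _ _ (λ c → ¬? (f c ≟ e)) (λ f≢e → ¬missed (e , f≢e)) =
    c , decidable-stable (f c ≟ e) ¬fc≢e

  section-injective : Injective _≡_ _≡_ (proj₁ ∘ preimage)
  section-injective {x} {y} eq =
    trans (sym (proj₂ (preimage x))) (trans (cong f eq) (proj₂ (preimage y)))

-- Adjoining the two missed values would inject Fin (2 + n) into Fin (1 + n).
injection-misses-at-most-one : ∀ {n} (f : Fin n → Fin (suc n)) → Injective _≡_ _≡_ f →
                               ∀ {e e'} → e ≢ e' → (∀ c → f c ≢ e) → (∀ c → f c ≢ e') → ⊥
injection-misses-at-most-one {n} f f-injective {e} {e'} e≢e' f≢e f≢e' =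
  Finₚ.<⇒notInjective (ℕₚ.n<1+n (suc n)) extended-injective
  where
  extended : Fin (2 + n) → Fin (suc n)
  extended zero          = e
  extended (suc zero)    = e'
  extended (suc (suc c)) = f c

  extended-injective : Injective _≡_ _≡_ extended
  extended-injective {zero}        {zero}         _  = refl
  extended-injective {zero}        {suc zero}     eq = contradiction eq e≢e'
  extended-injective {zero}        {suc (suc c)}  eq = contradiction (sym eq) (f≢e c)
  extended-injective {suc zero}    {zero}         eq = contradiction (sym eq) e≢e'
  extended-injective {suc zero}    {suc zero}     _  = refl
  extended-injective {suc zero}    {suc (suc c)}  eq = contradiction (sym eq) (f≢e' c)
  extended-injective {suc (suc c)} {zero}         eq = contradiction eq (f≢e c)
  extended-injective {suc (suc c)} {suc zero}     eq = contradiction eq (f≢e' c)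
  extended-injective {suc (suc c)} {suc (suc c')} eq = cong (λ c → suc (suc c)) (f-injective eq)

spike : ∀ {p} → Fin p → Fin p → Fin 2
spike zero    zero    = zero
spike zero    (suc _) = suc zero
spike (suc _) zero    = suc zero
spike (suc i) (suc c) = spike i c

spike-diag : ∀ {p} (i : Fin p) → spike i i ≡ zero
spike-diag zero    = refl
spike-diag (suc i) = spike-diag i

spike-≢ : ∀ {p} {i c : Fin p} → c ≢ i → spike i c ≡ suc zero
spike-≢ {i = zero}  {zero}  c≢i = contradiction refl c≢i
spike-≢ {i = zero}  {suc _} _   = refl
spike-≢ {i = suc _} {zero}  _   = refl
spike-≢ {i = suc _} {suc _} c≢i = spike-≢ (c≢i ∘ cong suc)

EqualSpikeMinors : ∀ {k p} → ((Fin p → Fin 2) → Fin k) → Set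
EqualSpikeMinors f = ∀ i j y → minorFun (spike i) f y ≡ minorFun (spike j) f y

ξ-preserves-minor-identity : ∀ {r k r' k' p q} (H : MinionHom r k r' k')
                             (π σ : Fin p → Fin q) (f : Pol r k p) →
                             (∀ x → minorFun π (fun f) x ≡ minorFun σ (fun f) x) →
                             let g = MinionHom.ξ H f in
                             ∀ x → minorFun π (fun g) x ≡ minorFun σ (fun g) x
ξ-preserves-minor-identity H π σ f f-identity x = begin
  minorFun π (fun (ξ f)) x  ≡⟨ ξ-minor π f x ⟨
  fun (ξ (minor π f)) x     ≡⟨ ξ-ext (minor π f) (minor σ f) f-identity x ⟩
  fun (ξ (minor σ f)) x     ≡⟨ ξ-minor σ f x ⟩
  minorFun σ (fun (ξ f)) x  ∎
  where open MinionHom H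
        open ≡-Reasoning

no-polymorphism-with-equal-spike-minors : ∀ {m k} (g : Pol (4 + m) k (2 + m)) →
                                          ¬ EqualSpikeMinors (fun g)
no-polymorphism-with-equal-spike-minors {m} {k} (g , g-pol) spikes =
  no-unique-max (g-pol rows columns)
  where
  -- On Fin 2, opposite swaps 0 and 1, so row 2 + i is the indicator of
  -- column i and is the minor along spike i of the tuple opposite.
  rows : Fin (4 + m) → Fin (2 + m) → Fin 2
  rows (suc (suc i)) c = opposite (spike i c)
  rows _             _ = zero

  columns : ∀ c → LO 2 (4 + m) (λ r → rows r c)
  columns c = suc (suc c) , λ r r≢ → subst₂ _<_ (sym (off-diagonal r r≢)) (sym diagonal) ℕ.z<s
    where
    diagonal : rows (suc (suc c)) c ≡ suc zero
    diagonal = cong opposite (spike-diag c)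

    off-diagonal : ∀ r → r ≢ suc (suc c) → rows r c ≡ zero
    off-diagonal zero          _   = refl
    off-diagonal (suc zero)    _   = refl
    off-diagonal (suc (suc i)) r≢ =
      cong opposite (spike-≢ λ c≡i → r≢ (cong (λ j → suc (suc j)) (sym c≡i)))

  twin : ∀ w → ∃ λ r → r ≢ w × g (rows r) ≡ g (rows w)
  twin zero                = suc zero , (λ ()) , refl
  twin (suc zero)          = zero , (λ ()) , refl
  twin (suc (suc zero))    = suc (suc (suc zero)) , (λ ()) , spikes (suc zero) zero opposite
  twin (suc (suc (suc i))) = suc (suc zero) , (λ ()) , spikes zero (suc i) opposite

  no-unique-max : ¬ LO k (4 + m) (λ r → g (rows r))
  no-unique-max (w , w-max) with r , r≢w , same ← twin w = Finₚ.<-irrefl same (w-max r r≢w)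

IsFirstOne : ∀ {n} → (Fin n → Fin 2) → Fin n → Set
IsFirstOne S c = S c ≡ suc zero × (∀ b → b < c → S b ≡ zero)

AnotherOne : ∀ {n} → (Fin n → Fin 2) → Fin n → Set
AnotherOne S c = ∃ λ d → d ≢ c × S d ≡ suc zero

anotherOne? : ∀ {n} (S : Fin n → Fin 2) c → Dec (AnotherOne S c)
anotherOne? S c = Finₚ.any? λ d → ¬? (d ≟ c) ×-dec (S d ≟ suc zero)

firstOne-< : ∀ {n} {S : Fin n → Fin 2} {c d} → IsFirstOne S c → d ≢ c → S d ≡ suc zero → c < d
firstOne-< (_ , below) d≢c Sd =
  Finₚ.≤∧≢⇒< (ℕₚ.≮⇒≥ λ d<c → Finₚ.0≢1+n (trans (sym (below _ d<c)) Sd)) (d≢c ∘ sym)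

prependFirstOne : ∀ {n} → Fin 2 → Maybe (Fin n) → Maybe (Fin (suc n))
prependFirstOne zero       = Maybe.map suc
prependFirstOne (suc zero) = λ _ → just zero

firstOne : ∀ {n} → (Fin n → Fin 2) → Maybe (Fin n)
firstOne {zero}  S = nothing
firstOne {suc n} S = prependFirstOne (S zero) (firstOne (S ∘ suc))

firstOne-empty : ∀ {n} {S : Fin n → Fin 2} → (∀ c → S c ≡ zero) → firstOne S ≡ nothing
firstOne-empty {zero}  _       = refl
firstOne-empty {suc n} allZero =
  cong₂ prependFirstOne (allZero zero) (firstOne-empty (allZero ∘ suc))

firstOne-least : ∀ {n} {S : Fin n → Fin 2} {c} → IsFirstOne S c → firstOne S ≡ just c
firstOne-least {S = S} {c = zero} (S0 , _) = cong (λ a → prependFirstOne a (firstOne (S ∘ suc))) S0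
firstOne-least {c = suc c} (Sc , below) =
  cong₂ prependFirstOne (below zero ℕ.z<s)
                        (firstOne-least (Sc , λ b b<c → below (suc b) (ℕ.s<s b<c)))

data Shape {n} (S : Fin n → Fin 2) : Set where
  empty    : (∀ c → S c ≡ zero) → Shape S
  single   : ∀ {c} → S c ≡ suc zero → (∀ d → d ≢ c → S d ≡ zero) → Shape S
  multiple : ∀ {c} → IsFirstOne S c → AnotherOne S c → Shape S

shape : ∀ {n} (S : Fin n → Fin 2) → Shape S
shape S with Finₚ.all? (λ c → S c ≟ zero)
... | yes allZero = empty allZero
... | no ¬allZero with c , Sc≢0 , below ← ¬∀⟶∃¬-least (λ c → S c ≟ zero) ¬allZero
                  with anotherOne? S c
...   | yes another = multiple (≢0⇒≡1 Sc≢0 , below) another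
...   | no ¬another = single (≢0⇒≡1 Sc≢0) λ d d≢c → ≢1⇒≡0 λ Sd → ¬another (d , d≢c , Sd)

module _ {n : ℕ} where

  spikeZero? : (S : Fin (suc n) → Fin 2) → Dec (S ≗ spike zero)
  spikeZero? S = Finₚ.all? λ c → S c ≟ spike zero c

  scoreMany : {S : Fin (suc n) → Fin 2} → Dec (S ≗ spike zero) → Fin (suc n) → ℕ
  scoreMany (yes _) _ = suc n
  scoreMany (no _)  c = suc n ∸ toℕ c

  -- Rows without a one score 1, rows with a single one score 0, and a row
  -- with several ones, the first in column c, scores n + 1 − c.  The one
  -- exception is the row 0 1 ⋯ 1 (= spike zero), which scores n + 1 like all
  -- other rows with a single zero.
  score : (Fin (suc n) → Fin 2) → Maybe (Fin (suc n)) → ℕ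
  score S nothing  = 1
  score S (just c) with anotherOne? S c
  ... | yes _ = scoreMany (spikeZero? S) c
  ... | no _  = 0

  value : (Fin (suc n) → Fin 2) → ℕ
  value S = score S (firstOne S)

  value-≤ : ∀ S → value S ≤ suc n
  value-≤ S = score-≤ (firstOne S)
    where
    scoreMany-≤ : (a? : Dec (S ≗ spike zero)) (c : Fin (suc n)) → scoreMany a? c ≤ suc n
    scoreMany-≤ (yes _) _ = ℕₚ.≤-refl
    scoreMany-≤ (no _)  c = ℕₚ.m∸n≤m (suc n) (toℕ c)

    score-≤ : ∀ x → score S x ≤ suc n
    score-≤ nothing = ℕ.s≤s ℕ.z≤n
    score-≤ (just c) with anotherOne? S c
    ... | yes _ = scoreMany-≤ (spikeZero? S) c
    ... | no _  = ℕ.z≤n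

  value-empty : ∀ {S} → (∀ c → S c ≡ zero) → value S ≡ 1
  value-empty {S} allZero = cong (score S) (firstOne-empty allZero)

  value-single : ∀ {S c} → S c ≡ suc zero → (∀ d → d ≢ c → S d ≡ zero) → value S ≡ 0
  value-single {S} {c} Sc others rewrite firstOne-least (Sc , λ b b<c → others b (Finₚ.<⇒≢ b<c))
    with anotherOne? S c
  ... | no _                   = refl
  ... | yes (d , d≢c , Sd) = contradiction (trans (sym (others d d≢c)) Sd) Finₚ.0≢1+n

  value-multiple : ∀ {S c} → IsFirstOne S c → AnotherOne S c → value S ≡ scoreMany (spikeZero? S) c
  value-multiple {S} {c} first another rewrite firstOne-least first with anotherOne? S c
  ... | yes _       = refl
  ... | no ¬another = contradiction another ¬another

  scoreMany-≥ : ∀ {S} (a? : Dec (S ≗ spike zero)) c → suc n ∸ toℕ c ≤ scoreMany a? c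
  scoreMany-≥ (yes _) c = ℕₚ.m∸n≤m (suc n) (toℕ c)
  scoreMany-≥ (no _)  _ = ℕₚ.≤-refl

  scoreMany-no : ∀ {S} (a? : Dec (S ≗ spike zero)) {c} → ¬ S ≗ spike zero →
                 scoreMany a? c ≡ suc n ∸ toℕ c
  scoreMany-no (yes a) ¬a = contradiction a ¬a
  scoreMany-no (no _)  _  = refl

  value-first-column : ∀ {S} → S zero ≡ suc zero → AnotherOne S zero → value S ≡ suc n
  value-first-column {S} S0 another =
    trans (value-multiple (S0 , λ _ ()) another) (scoreMany-zero (spikeZero? S))
    where
    scoreMany-zero : (a? : Dec (S ≗ spike zero)) → scoreMany a? zero ≡ suc n
    scoreMany-zero (yes _) = refl
    scoreMany-zero (no _)  = refl

module ScoreMaximum {n : ℕ} (M : Fin (2 + n) → Fin (suc n) → Fin 2)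
                    (columns : ∀ c → LO 2 (2 + n) λ r → M r c) where

  owner : Fin (suc n) → Fin (2 + n)
  owner c = proj₁ (columns c)

  M-owner : ∀ c → M (owner c) c ≡ suc zero
  M-owner c = LO₂-top (columns c)

  M-other : ∀ {r c} → r ≢ owner c → M r c ≡ zero
  M-other {r} {c} = LO₂-rest (columns c) r

  owner-unique : ∀ {r c} → M r c ≡ suc zero → owner c ≡ r
  owner-unique {r} {c} Mrc = decidable-stable (owner c ≟ r) λ oc≢r →
    Finₚ.0≢1+n (trans (sym (M-other (oc≢r ∘ sym))) Mrc)

  Shared : Fin (suc n) → Set
  Shared c = ∃ λ d → d ≢ c × owner d ≡ owner c

  shared? : ∀ c → Dec (Shared c)
  shared? c = Finₚ.any? λ d → ¬? (d ≟ c) ×-dec (owner d ≟ owner c)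

  unshared-max : (∀ c → ¬ Shared c) → StrictMax (value ∘ M)
  unshared-max unshared with e , e-unowned ← some-value-missed owner =
    e , λ r r≢e → subst₂ ℕ._<_ (sym (owned-value r r≢e)) (sym e-value) ℕ.z<s
    where
    owner-injective : Injective _≡_ _≡_ owner
    owner-injective {a} {b} eq = decidable-stable (a ≟ b) λ a≢b → unshared b (a , a≢b , eq)

    e-value : value (M e) ≡ 1
    e-value = value-empty λ c → M-other λ e≡oc → e-unowned c (sym e≡oc)

    owned : ∀ r → r ≢ e → ∃ λ c → owner c ≡ r
    owned r r≢e = decidable-stable (Finₚ.any? λ c → owner c ≟ r) λ unowned →
      injection-misses-at-most-one owner owner-injective r≢e
                                   (λ c oc≡r → unowned (c , oc≡r)) e-unowned

    owned-value : ∀ r → r ≢ e → value (M r) ≡ 0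
    owned-value r r≢e with c , oc≡r ← owned r r≢e =
      value-single (subst (λ r → M r c ≡ suc zero) oc≡r (M-owner c))
                   λ d d≢c → M-other λ r≡od → unshared c (d , d≢c , trans (sym r≡od) (sym oc≡r))

  module _ {c d} (d≢c : d ≢ c) (od≡oc : owner d ≡ owner c)
           (unshared-below : ∀ b → b < c → ¬ Shared b) where

    winner-first : IsFirstOne (M (owner c)) c
    winner-first = M-owner c , λ b b<c → M-other λ oc≡ob →
      unshared-below b b<c (c , (Finₚ.<⇒≢ b<c ∘ sym) , oc≡ob)

    winner-another : AnotherOne (M (owner c)) c
    winner-another = d , d≢c , subst (λ r → M r d ≡ suc zero) od≡oc (M-owner d)

    c<d : c < d
    c<d = firstOne-< winner-first d≢c (proj₂ (proj₂ winner-another))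

    winner-value : suc n ∸ toℕ c ≤ value (M (owner c))
    winner-value = subst (_ ≤_) (sym (value-multiple winner-first winner-another))
                         (scoreMany-≥ (spikeZero? (M (owner c))) c)

    1<winner-score : 1 ℕ.< suc n ∸ toℕ c
    1<winner-score = ℕₚ.≤-<-trans (ℕₚ.m<n⇒0<n∸m (Finₚ.toℕ<n d))
                                   (ℕₚ.∸-monoʳ-< c<d (ℕₚ.<⇒≤ (Finₚ.toℕ<n d)))

    module _ {r c'} (r≢w : r ≢ owner c) (first : IsFirstOne (M r) c')
             (another : AnotherOne (M r) c') where

      c'-shared : Shared c'
      c'-shared = let d' , d'≢c' , Mrd' = another in
        d' , d'≢c' , trans (owner-unique Mrd') (sym (owner-unique (proj₁ first)))

      loser-first-later : c < c'
      loser-first-later = Finₚ.≤∧≢⇒< (ℕₚ.≮⇒≥ λ c'<c → unshared-below c' c'<c c'-shared) λ c≡c' →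
        r≢w (trans (sym (owner-unique (proj₁ first))) (cong owner (sym c≡c')))

      loser-not-spike : ¬ M r ≗ spike zero
      loser-not-spike Mr≗spike = r≢w (trans (sym (owner-unique Mrd)) od≡oc)
        where
        Mrd : M r d ≡ suc zero
        Mrd = trans (Mr≗spike d) (spike-≢ λ d≡0 → ℕₚ.n≮0 (subst (c <_) d≡0 c<d))

      loser-value : value (M r) ℕ.< suc n ∸ toℕ c
      loser-value = subst (ℕ._< _) (sym value-eq)
                          (ℕₚ.∸-monoʳ-< loser-first-later (ℕₚ.<⇒≤ (Finₚ.toℕ<n c')))
        where
        value-eq : value (M r) ≡ suc n ∸ toℕ c'
        value-eq = trans (value-multiple first another)
                         (scoreMany-no (spikeZero? (M r)) loser-not-spike)

    shared-max : StrictMax (value ∘ M)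
    shared-max = owner c , λ r r≢w → ℕₚ.<-≤-trans (loser r r≢w (shape (M r))) winner-value
      where
      loser : ∀ r → r ≢ owner c → Shape (M r) → value (M r) ℕ.< suc n ∸ toℕ c
      loser r r≢w (empty allZero)          =
        subst (ℕ._< _) (sym (value-empty allZero)) 1<winner-score
      loser r r≢w (single Sc others)       =
        subst (ℕ._< _) (sym (value-single Sc others)) (ℕₚ.<-trans ℕ.z<s 1<winner-score)
      loser r r≢w (multiple first another) = loser-value r≢w first another

  value-strict-max : StrictMax (value ∘ M)
  value-strict-max with Finₚ.all? (λ c → ¬? (shared? c))
  ... | yes unshared = unshared-max unshared
  ... | no ¬unshared with c , ¬¬shared , below ← ¬∀⟶∃¬-least (λ c → ¬? (shared? c)) ¬unshared
                     with d , d≢c , od≡oc ← decidable-stable (shared? c) ¬¬shared =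
    shared-max d≢c od≡oc below

valueFin : ∀ {n} → (Fin (suc n) → Fin 2) → Fin (2 + n)
valueFin S = fromℕ< (ℕ.s≤s (value-≤ S))

valueFin-polymorphism : ∀ {n} → IsPol (2 + n) (2 + n) (suc n) valueFin
valueFin-polymorphism M columns with w , w-max ← ScoreMaximum.value-strict-max M columns =
  w , λ r r≢w → subst₂ ℕ._<_ (sym (Finₚ.toℕ-fromℕ< _)) (sym (Finₚ.toℕ-fromℕ< _)) (w-max r r≢w)

-- With only two columns, a row with a single zero has a single one.
spikeMinorValue : ℕ → Fin 2 → Fin 2 → ℕ
spikeMinorValue _       zero       zero       = 1
spikeMinorValue _       (suc zero) zero       = 0
spikeMinorValue m       (suc zero) (suc zero) = 2 + m
spikeMinorValue zero    zero       (suc zero) = 0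
spikeMinorValue (suc m) zero       (suc zero) = 3 + m

value-single-zero : ∀ {m} {S : Fin (2 + m) → Fin 2} i → S i ≡ zero → (∀ c → c ≢ i → S c ≡ suc zero) →
                    value S ≡ spikeMinorValue m zero (suc zero)
value-single-zero {zero} {S} zero       S0 others =
  value-single {S = S} (others (suc zero) λ ()) λ where
    zero       _   → S0
    (suc zero) 1≢1 → contradiction refl 1≢1
value-single-zero {zero} {S} (suc zero) S1 others =
  value-single {S = S} (others zero λ ()) λ where
    zero       0≢0 → contradiction refl 0≢0
    (suc zero) _   → S1
value-single-zero {suc m} {S} zero S0 others =
  trans (value-multiple {S = S} first (suc (suc zero) , (λ ()) , others _ λ ()))
        (scoreMany-yes (spikeZero? S))
  where
  first : IsFirstOne S (suc zero)
  first = others _ (λ ()) , λ { zero _ → S0 ; (suc _) (ℕ.s≤s ()) }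

  S≗spike : S ≗ spike zero
  S≗spike zero    = S0
  S≗spike (suc c) = others (suc c) λ ()

  scoreMany-yes : (a? : Dec (S ≗ spike zero)) → scoreMany a? (suc zero) ≡ 3 + m
  scoreMany-yes (yes _)        = refl
  scoreMany-yes (no ¬S≗spike) = contradiction S≗spike ¬S≗spike
value-single-zero {suc m} {S} (suc zero) _ others =
  value-first-column {S = S} (others zero λ ()) (suc (suc zero) , (λ ()) , others _ λ ())
value-single-zero {suc m} {S} (suc (suc _)) _ others =
  value-first-column {S = S} (others zero λ ()) (suc zero , (λ ()) , others _ λ ())

value-spike-pattern : ∀ {m} {S : Fin (2 + m) → Fin 2} i {a b} → S i ≡ a → (∀ c → c ≢ i → S c ≡ b) →
                      value S ≡ spikeMinorValue m a b
value-spike-pattern {S = S} i {zero}     {zero}     Si others =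
  value-empty {S = S} (constant-except Si others)
value-spike-pattern {S = S} i {suc zero} {zero}     Si others = value-single {S = S} Si others
value-spike-pattern {S = S} i {suc zero} {suc zero} Si others =
  value-first-column {S = S} (one zero) (suc zero , (λ ()) , one (suc zero))
  where
  one : ∀ c → S c ≡ suc zero
  one = constant-except Si others
value-spike-pattern         i {zero}     {suc zero} Si others = value-single-zero i Si others

valueFin-equal-spike-minors : ∀ {m} → EqualSpikeMinors (valueFin {suc m})
valueFin-equal-spike-minors {m} i j y =
  Finₚ.fromℕ<-cong _ _ (trans (minor-value i) (sym (minor-value j))) _ _
  where
  minor-value : ∀ i → value (y ∘ spike i) ≡ spikeMinorValue m (y zero) (y (suc zero))
  minor-value i = value-spike-pattern i (cong y (spike-diag i)) λ c c≢i → cong y (spike-≢ c≢i)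

theorem5p22 : (k : ℕ) → 3 ≤ k → NoHom k k (suc k) k
theorem5p22 (suc (suc (suc m))) (ℕ.s≤s (ℕ.s≤s (ℕ.s≤s ℕ.z≤n))) H =
  no-polymorphism-with-equal-spike-minors (ξ f) λ i j →
    ξ-preserves-minor-identity H (spike i) (spike j) f (valueFin-equal-spike-minors i j)
  where
  open MinionHom H

  f : Pol (3 + m) (3 + m) (2 + m)
  f = valueFin , valueFin-polymorphism
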